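{- Let $n$ be an integer, $m$ a nonnegative integer, and $p$ an integer with $0\le p\le 2n+\lfloor m/2\rfloor-3$. Then there is a polynomial $\beta$ of degree at most $2(2n+\lfloor m/2\rfloor-3-p)$ such that for all integers $j$ with $1\le j\le n-1$, the coefficient of $x^p$ in $$(2x+m+1)_j\,(x-j+2)_{\lfloor m/2\rfloor+j-1}\,(x+m+2j+1)_{2n-2j-2}$$ equals $2^j\beta(j)$.
   Context: $(u)_k=u(u+1)\cdots(u+k-1)$ for $k\ge1$, $(u)_0=1$; the expression is a polynomial in $x$. -}

module Defs where

open import Data.Nat as ℕ using (ℕ; zero; suc)
open import Data.Integer as ℤ using (ℤ; +_)
open import Data.Rational as ℚ using (ℚ)
open import Data.List using (List; []; _∷_)
open import Data.Vec using (Vec; []; _∷_)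

-- Polynomials in x with integer coefficients, as coefficient lists,
-- lowest degree first: a₀ ∷ a₁ ∷ … represents a₀ + a₁ x + ….
Poly : Set
Poly = List ℤ

addP : Poly → Poly → Poly
addP [] q = q
addP (a ∷ p) [] = a ∷ p
addP (a ∷ p) (b ∷ q) = (a ℤ.+ b) ∷ addP p q

scaleP : ℤ → Poly → Poly
scaleP c [] = []
scaleP c (a ∷ p) = (c ℤ.* a) ∷ scaleP c p

mulP : Poly → Poly → Poly
mulP [] q = []
mulP (a ∷ p) q = addP (scaleP a q) (ℤ.+ 0 ∷ mulP p q)

oneP : Poly
oneP = ℤ.+ 1 ∷ []

coeff : Poly → ℕ → ℤ
coeff [] k = ℤ.+ 0
coeff (a ∷ p) zero = a
coeff (a ∷ p) (suc k) = coeff p k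

-- Rising factorial (u)_k = u (u+1) ⋯ (u+k-1), (u)_0 = 1, for the
-- linear polynomial u = a x + b.
pochLin : (a b : ℤ) → ℕ → Poly
pochLin a b zero = oneP
pochLin a b (suc k) = mulP (pochLin a b k) ((b ℤ.+ + k) ∷ a ∷ [])

evalℚ : ∀ {d} → Vec ℚ d → ℚ → ℚ
evalℚ [] t = ℚ.0ℚ
evalℚ (c ∷ cs) t = c ℚ.+ t ℚ.* evalℚ cs t

toℚ : ℤ → ℚ
toℚ z = z ℚ./ 1

{-# OPTIONS --safe #-}
module Submission where

open import Defs
open import Data.Nat as ℕ using (ℕ; _∸_; ⌊_/2⌋)
open import Data.Integer as ℤ using (ℤ; +_; ∣_∣)
open import Data.Rational as ℚ using (ℚ)
open import Data.Vec using (Vec)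
open import Data.Product using (Σ; _×_)
open import Relation.Binary.PropositionalEquality using (_≡_)

open import Level using (0ℓ)
open import Function using (_∘_; id)
open import Relation.Nullary.Decidable.Core using (dec⇒maybe)
open import Data.List using (List; []; _∷_)
open import Data.Nat using (zero; suc; z≤n; s≤s; _≤_; _<_; _≤′_; ≤′-refl; ≤′-step)
import Data.Nat.Properties as ℕP
import Data.Integer.Properties as ℤP
open import Data.Rational using (0ℚ; 1ℚ; ½; _+_; _*_; -_; _-_)
import Data.Rational.Properties as ℚP
import Data.Rational.Unnormalised as ℚᵘ
import Data.Rational.Unnormalised.Properties as ℚᵘP
open import Algebra.Definitions.RawSemiring ℚ.+-*-rawSemiring using (_^_)
open import Data.Vec as Vec using ([]; _∷_; _∷ʳ_)
open import Data.Product as Product using (_,_; proj₁; proj₂)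
open import Relation.Binary.PropositionalEquality
  using (refl; sym; trans; cong; cong₂; subst; _≗_; _→-setoid_; module ≡-Reasoning)
import Relation.Binary.Reasoning.Setoid as SetoidReasoning
import Tactic.RingSolver as RingSolver
import Tactic.RingSolver.Core.AlmostCommutativeRing as ACR
open import Data.Integer.Tactic.RingSolver using () renaming (solve-∀ to solveℤ)
open import Data.Nat.Tactic.RingSolver using () renaming (solve-∀ to solveℕ)

ℚ-ring : ACR.AlmostCommutativeRing 0ℓ 0ℓ
ℚ-ring = ACR.fromCommutativeRing ℚP.+-*-commutativeRing (λ x → dec⇒maybe (0ℚ ℚP.≟ x))

private
  variable
    d e : ℕ
    f g : ℚ → ℚ
    F : ℕ → ℚ

toℚᵘ-toℚ : ∀ a → ℚ.toℚᵘ (toℚ a) ℚᵘ.≃ ℚᵘ.mkℚᵘ a 0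
toℚᵘ-toℚ a = ℚP.toℚᵘ-fromℚᵘ (ℚᵘ.mkℚᵘ a 0)

toℚ-+ : ∀ a b → toℚ (a ℤ.+ b) ≡ toℚ a + toℚ b
toℚ-+ a b = ℚP.toℚᵘ-injective (begin
  ℚ.toℚᵘ (toℚ (a ℤ.+ b))              ≈⟨ toℚᵘ-toℚ (a ℤ.+ b) ⟩
  ℚᵘ.mkℚᵘ (a ℤ.+ b) 0                 ≈⟨ ℚᵘ.*≡* (cong (ℤ._* + 1) (cong₂ ℤ._+_ (sym (ℤP.*-identityʳ a)) (sym (ℤP.*-identityʳ b)))) ⟩
  ℚᵘ.mkℚᵘ a 0 ℚᵘ.+ ℚᵘ.mkℚᵘ b 0        ≈⟨ ℚᵘP.+-cong (toℚᵘ-toℚ a) (toℚᵘ-toℚ b) ⟨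
  ℚ.toℚᵘ (toℚ a) ℚᵘ.+ ℚ.toℚᵘ (toℚ b)  ≈⟨ ℚP.toℚᵘ-homo-+ (toℚ a) (toℚ b) ⟨
  ℚ.toℚᵘ (toℚ a + toℚ b)              ∎)
  where open ℚᵘP.≃-Reasoning

toℚ-* : ∀ a b → toℚ (a ℤ.* b) ≡ toℚ a * toℚ b
toℚ-* a b = ℚP.toℚᵘ-injective (begin
  ℚ.toℚᵘ (toℚ (a ℤ.* b))              ≈⟨ toℚᵘ-toℚ (a ℤ.* b) ⟩
  ℚᵘ.mkℚᵘ a 0 ℚᵘ.* ℚᵘ.mkℚᵘ b 0        ≈⟨ ℚᵘP.*-cong (toℚᵘ-toℚ a) (toℚᵘ-toℚ b) ⟨
  ℚ.toℚᵘ (toℚ a) ℚᵘ.* ℚ.toℚᵘ (toℚ b)  ≈⟨ ℚP.toℚᵘ-homo-* (toℚ a) (toℚ b) ⟨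
  ℚ.toℚᵘ (toℚ a * toℚ b)              ∎)
  where open ℚᵘP.≃-Reasoning

fromℕ : ℕ → ℚ
fromℕ n = toℚ (+ n)

fromℕ-suc : ∀ n → fromℕ (suc n) ≡ fromℕ n + 1ℚ
fromℕ-suc n = trans (toℚ-+ (+ 1) (+ n)) (ℚP.+-comm 1ℚ (fromℕ n))

fromℕ-suc-*-inverse : ∀ n → fromℕ (suc n) * (+ 1 ℚ./ suc n) ≡ 1ℚ
fromℕ-suc-*-inverse n = ℚP.toℚᵘ-injective (begin
  ℚ.toℚᵘ (fromℕ (suc n) * (+ 1 ℚ./ suc n))             ≈⟨ ℚP.toℚᵘ-homo-* (fromℕ (suc n)) (+ 1 ℚ./ suc n) ⟩
  ℚ.toℚᵘ (fromℕ (suc n)) ℚᵘ.* ℚ.toℚᵘ (+ 1 ℚ./ suc n)  ≈⟨ ℚᵘP.*-cong (toℚᵘ-toℚ (+ suc n)) (ℚP.toℚᵘ-fromℚᵘ (ℚᵘ.mkℚᵘ (+ 1) n)) ⟩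
  ℚᵘ.mkℚᵘ (+ suc n) 0 ℚᵘ.* ℚᵘ.mkℚᵘ (+ 1) n             ≈⟨ ℚᵘP.*-inverseʳ (ℚᵘ.mkℚᵘ (+ suc n) 0) ⟩
  ℚᵘ.1ℚᵘ                                               ∎)
  where open ℚᵘP.≃-Reasoning

2^*½^≡1 : ∀ j → toℚ (+ (2 ℕ.^ j)) * ½ ^ j ≡ 1ℚ
2^*½^≡1 zero    = refl
2^*½^≡1 (suc j) = begin
  toℚ (+ (2 ℕ.* 2 ℕ.^ j)) * (½ * ½ ^ j)      ≡⟨ cong (λ z → toℚ z * (½ * ½ ^ j)) (ℤP.pos-* 2 (2 ℕ.^ j)) ⟩
  toℚ (+ 2 ℤ.* + (2 ℕ.^ j)) * (½ * ½ ^ j)    ≡⟨ cong (_* (½ * ½ ^ j)) (toℚ-* (+ 2) (+ (2 ℕ.^ j))) ⟩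
  (toℚ (+ 2) * toℚ (+ (2 ℕ.^ j))) * (½ * ½ ^ j)  ≡⟨ swap (toℚ (+ 2)) (toℚ (+ (2 ℕ.^ j))) ½ (½ ^ j) ⟩
  (toℚ (+ 2) * ½) * (toℚ (+ (2 ℕ.^ j)) * ½ ^ j)  ≡⟨ cong (1ℚ *_) (2^*½^≡1 j) ⟩
  1ℚ ∎
  where
  open ≡-Reasoning
  swap : ∀ a b c d → (a * b) * (c * d) ≡ (a * c) * (b * d)
  swap = RingSolver.solve-∀ ℚ-ring

*½^-unscale : ∀ j x → x ≡ toℚ (+ (2 ℕ.^ j)) * (x * ½ ^ j)
*½^-unscale j x = begin
  x                          ≡⟨ ℚP.*-identityʳ x ⟨
  x * 1ℚ                     ≡⟨ cong (x *_) (2^*½^≡1 j) ⟨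
  x * (2^j * ½ ^ j)          ≡⟨ exchange x 2^j (½ ^ j) ⟩
  2^j * (x * ½ ^ j)          ∎
  where
  open ≡-Reasoning
  2^j = toℚ (+ (2 ℕ.^ j))
  exchange : ∀ x a b → x * (a * b) ≡ a * (x * b)
  exchange = RingSolver.solve-∀ ℚ-ring

Poly< : ℕ → (ℚ → ℚ) → Set
Poly< d f = Σ (Vec ℚ d) λ cs → f ≗ evalℚ cs

poly<-cong : f ≗ g → Poly< d f → Poly< d g
poly<-cong f≗g (cs , f≗cs) = cs , λ t → trans (sym (f≗g t)) (f≗cs t)

poly<-∷ : ∀ c → Poly< d f → Poly< (suc d) (λ t → c + t * f t)
poly<-∷ c (cs , f≗cs) = c ∷ cs , λ t → cong (λ y → c + t * y) (f≗cs t)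

poly<-zero : ∀ d → Poly< d (λ _ → 0ℚ)
poly<-zero zero    = [] , λ _ → refl
poly<-zero (suc d) = poly<-cong (λ t → trans (ℚP.+-identityˡ _) (ℚP.*-zeroʳ t)) (poly<-∷ 0ℚ (poly<-zero d))

poly<-const : ∀ c → Poly< 1 (λ _ → c)
poly<-const c = poly<-cong (λ t → trans (cong (λ y → c + y) (ℚP.*-zeroʳ t)) (ℚP.+-identityʳ c)) (poly<-∷ c (poly<-zero 0))

poly<-X* : Poly< d f → Poly< (suc d) (λ t → t * f t)
poly<-X* p = poly<-cong (λ t → ℚP.+-identityˡ _) (poly<-∷ 0ℚ p)

evalℚ-zipWith-+ : ∀ (cs ds : Vec ℚ d) t → evalℚ (Vec.zipWith _+_ cs ds) t ≡ evalℚ cs t + evalℚ ds t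
evalℚ-zipWith-+ []       []       t = sym (ℚP.+-identityˡ 0ℚ)
evalℚ-zipWith-+ (c ∷ cs) (d ∷ ds) t =
  trans (cong (λ y → (c + d) + t * y) (evalℚ-zipWith-+ cs ds t)) (distrib c d t (evalℚ cs t) (evalℚ ds t))
  where
  distrib : ∀ c d t x y → (c + d) + t * (x + y) ≡ (c + t * x) + (d + t * y)
  distrib = RingSolver.solve-∀ ℚ-ring

poly<-+ : Poly< d f → Poly< d g → Poly< d (λ t → f t + g t)
poly<-+ (cs , f≗cs) (ds , g≗ds) =
  Vec.zipWith _+_ cs ds , λ t → trans (cong₂ _+_ (f≗cs t) (g≗ds t)) (sym (evalℚ-zipWith-+ cs ds t))

evalℚ-map-* : ∀ a (cs : Vec ℚ d) t → evalℚ (Vec.map (a *_) cs) t ≡ a * evalℚ cs t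
evalℚ-map-* a []       t = sym (ℚP.*-zeroʳ a)
evalℚ-map-* a (c ∷ cs) t =
  trans (cong (λ y → a * c + t * y) (evalℚ-map-* a cs t)) (distrib a c t (evalℚ cs t))
  where
  distrib : ∀ a c t x → a * c + t * (a * x) ≡ a * (c + t * x)
  distrib = RingSolver.solve-∀ ℚ-ring

poly<-scale : ∀ a → Poly< d f → Poly< d (λ t → a * f t)
poly<-scale a (cs , f≗cs) = Vec.map (a *_) cs , λ t → trans (cong (a *_) (f≗cs t)) (sym (evalℚ-map-* a cs t))

evalℚ-∷ʳ : ∀ (cs : Vec ℚ d) c t → evalℚ (cs ∷ʳ c) t ≡ evalℚ cs t + c * t ^ d
evalℚ-∷ʳ []       c t = base c t
  where
  base : ∀ c t → c + t * 0ℚ ≡ 0ℚ + c * 1ℚ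
  base = RingSolver.solve-∀ ℚ-ring
evalℚ-∷ʳ {suc d} (a ∷ cs) c t =
  trans (cong (λ y → a + t * y) (evalℚ-∷ʳ cs c t)) (distrib a t (evalℚ cs t) c (t ^ d))
  where
  distrib : ∀ a t x c T → a + t * (x + c * T) ≡ (a + t * x) + c * (t * T)
  distrib = RingSolver.solve-∀ ℚ-ring

poly<-suc : Poly< d f → Poly< (suc d) f
poly<-suc {d} (cs , f≗cs) = cs ∷ʳ 0ℚ , λ t → begin
  _                           ≡⟨ f≗cs t ⟩
  evalℚ cs t                  ≡⟨ ℚP.+-identityʳ _ ⟨
  evalℚ cs t + 0ℚ             ≡⟨ cong (λ y → evalℚ cs t + y) (ℚP.*-zeroˡ (t ^ d)) ⟨
  evalℚ cs t + 0ℚ * t ^ d     ≡⟨ evalℚ-∷ʳ cs 0ℚ t ⟨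
  evalℚ (cs ∷ʳ 0ℚ) t          ∎
  where open ≡-Reasoning

poly<-≤ : d ≤ e → Poly< d f → Poly< e f
poly<-≤ = raise ∘ ℕP.≤⇒≤′
  where
  raise : d ≤′ e → Poly< d f → Poly< e f
  raise ≤′-refl        = id
  raise (≤′-step d≤′e) = poly<-suc ∘ raise d≤′e

poly<-linear* : ∀ u v → Poly< d f → Poly< (suc d) (λ t → (u + v * t) * f t)
poly<-linear* {f = f} u v p =
  poly<-cong (λ t → distrib u v t (f t)) (poly<-+ (poly<-suc (poly<-scale u p)) (poly<-scale v (poly<-X* p)))
  where
  distrib : ∀ u v t x → u * x + v * (t * x) ≡ (u + v * t) * x
  distrib = RingSolver.solve-∀ ℚ-ring

evalℚ-shift : ∀ (cs : Vec ℚ d) → Poly< d (λ t → evalℚ cs (t + 1ℚ))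
evalℚ-shift []       = [] , λ _ → refl
evalℚ-shift (c ∷ cs) =
  poly<-cong (λ t → expand c t (evalℚ cs (t + 1ℚ)))
    (poly<-+ (poly<-≤ (s≤s z≤n) (poly<-const c)) (poly<-linear* 1ℚ 1ℚ (evalℚ-shift cs)))
  where
  expand : ∀ c t x → c + (1ℚ + 1ℚ * t) * x ≡ c + (t + 1ℚ) * x
  expand = RingSolver.solve-∀ ℚ-ring

poly<-shift : Poly< d f → Poly< d (λ t → f (t + 1ℚ))
poly<-shift (cs , f≗cs) = poly<-cong (λ t → sym (f≗cs (t + 1ℚ))) (evalℚ-shift cs)

poly<-pow : ∀ e → Poly< (suc e) (_^ e)
poly<-pow zero    = poly<-const 1ℚ
poly<-pow (suc e) = poly<-X* (poly<-pow e)

poly<-leading : Poly< (suc e) f → Σ ℚ λ a → Poly< e (λ t → f t - a * t ^ e)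
poly<-leading {e} {f} (cs , f≗cs) with Vec.initLast cs
... | ds , a , refl = a , ds , λ t → trans (cong (_- a * t ^ e) (trans (f≗cs t) (evalℚ-∷ʳ ds a t))) (cancel (evalℚ ds t) (a * t ^ e))
  where
  cancel : ∀ x y → (x + y) - y ≡ x
  cancel = RingSolver.solve-∀ ℚ-ring

shift-pow : ∀ e → Σ (ℚ → ℚ) λ R → Poly< e R × (∀ t → (t + 1ℚ) ^ suc e ≡ t ^ suc e + fromℕ (suc e) * t ^ e + R t)
shift-pow zero    = (λ _ → 0ℚ) , poly<-zero 0 , binomial
  where
  binomial : ∀ t → (t + 1ℚ) * 1ℚ ≡ t * 1ℚ + 1ℚ * 1ℚ + 0ℚ
  binomial = RingSolver.solve-∀ ℚ-ring
shift-pow (suc e) with shift-pow e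
... | R , pR , binomial = (λ t → E * t ^ e + (1ℚ + 1ℚ * t) * R t) ,
                          poly<-+ (poly<-scale E (poly<-pow e)) (poly<-linear* 1ℚ 1ℚ pR) ,
                          λ t → begin
  (t + 1ℚ) * (t + 1ℚ) ^ suc e                      ≡⟨ cong ((t + 1ℚ) *_) (binomial t) ⟩
  (t + 1ℚ) * (t * t ^ e + E * t ^ e + R t)          ≡⟨ expand t (t ^ e) E (R t) ⟩
  t * (t * t ^ e) + (E + 1ℚ) * (t * t ^ e) + (E * t ^ e + (1ℚ + 1ℚ * t) * R t)
                                                    ≡⟨ cong (λ z → t * (t * t ^ e) + z * (t * t ^ e) + (E * t ^ e + (1ℚ + 1ℚ * t) * R t)) (fromℕ-suc (suc e)) ⟨
  t * (t * t ^ e) + fromℕ (suc (suc e)) * (t * t ^ e) + (E * t ^ e + (1ℚ + 1ℚ * t) * R t) ∎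
  where
  open ≡-Reasoning
  E = fromℕ (suc e)
  expand : ∀ t T E R → (t + 1ℚ) * (t * T + E * T + R) ≡ t * (t * T) + (E + 1ℚ) * (t * T) + (E * T + (1ℚ + 1ℚ * t) * R)
  expand = RingSolver.solve-∀ ℚ-ring

Antidifference : ℕ → (ℚ → ℚ) → Set
Antidifference d f = Σ (ℚ → ℚ) λ g → Poly< d g × (∀ t → g (t + 1ℚ) ≡ g t + f t)

-- Up to a remainder of lower degree, t ^ e has the antidifference t ^ (e + 1) / (e + 1).
pow-antidifference : ∀ e → Σ (ℚ → ℚ) λ R → Poly< e R ×
  (∀ t → (+ 1 ℚ./ suc e) * (t + 1ℚ) ^ suc e ≡ (+ 1 ℚ./ suc e) * t ^ suc e + (t ^ e + R t))
pow-antidifference e with shift-pow e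
... | R , pR , binomial = (λ t → c * R t) , poly<-scale c pR , λ t → begin
  c * (t + 1ℚ) ^ suc e                          ≡⟨ cong (c *_) (binomial t) ⟩
  c * (t ^ suc e + fromℕ (suc e) * t ^ e + R t)  ≡⟨ distrib c (t ^ suc e) (fromℕ (suc e)) (t ^ e) (R t) ⟩
  c * t ^ suc e + ((fromℕ (suc e) * c) * t ^ e + c * R t)
                                                ≡⟨ cong (λ z → c * t ^ suc e + (z * t ^ e + c * R t)) (fromℕ-suc-*-inverse e) ⟩
  c * t ^ suc e + (1ℚ * t ^ e + c * R t)         ≡⟨ cong (λ z → c * t ^ suc e + (z + c * R t)) (ℚP.*-identityˡ (t ^ e)) ⟩
  c * t ^ suc e + (t ^ e + c * R t)              ∎
  where
  open ≡-Reasoning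
  c = + 1 ℚ./ suc e
  distrib : ∀ c T₁ E T R → c * (T₁ + E * T + R) ≡ c * T₁ + ((E * c) * T + c * R)
  distrib = RingSolver.solve-∀ ℚ-ring

antidifference : Poly< d f → Antidifference (suc d) f
antidifference {zero} ([] , f≗0) = (λ _ → 0ℚ) , poly<-zero 1 , λ t → sym (trans (ℚP.+-identityˡ _) (f≗0 t))
antidifference {suc e} {f} p =
  let a , pLow     = poly<-leading p
      R , pR , ΔR  = pow-antidifference e
      G , pG , ΔG  = antidifference (poly<-+ pLow (poly<-scale (- a) pR))
  in (λ t → a * g₀ t + G t) , poly<-+ (poly<-scale a pg₀) (poly<-suc pG) ,
     λ t → trans (cong₂ (λ x y → a * x + y) (ΔR t) (ΔG t)) (collect a (g₀ t) (t ^ e) (R t) (G t) (f t))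
  where
  g₀ : ℚ → ℚ
  g₀ t = (+ 1 ℚ./ suc e) * t ^ suc e
  pg₀ : Poly< (suc (suc e)) g₀
  pg₀ = poly<-scale (+ 1 ℚ./ suc e) (poly<-pow (suc e))
  collect : ∀ a g T R G f → a * (g + (T + R)) + (G + ((f - a * T) + (- a) * R)) ≡ (a * g + G) + f
  collect = RingSolver.solve-∀ ℚ-ring

AgreesOn : ℕ → (ℕ → ℚ) → (ℚ → ℚ) → Set
AgreesOn K F P = ∀ j → 1 ≤ j → j ≤ K → F j ≡ P (fromℕ j)

PolyOn : ℕ → ℕ → (ℕ → ℚ) → Set
PolyOn K d F = Σ (ℚ → ℚ) λ P → Poly< d P × AgreesOn K F P

polyOn-≤ : ∀ {K} → d ≤ e → PolyOn K d F → PolyOn K e F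
polyOn-≤ d≤e (P , pP , F≈P) = P , poly<-≤ d≤e pP , F≈P

polyOn-sum : ∀ {K} → Poly< d f → (∀ j → 1 ≤ j → suc j ≤ K → F (suc j) ≡ F j + f (fromℕ j)) → PolyOn K (suc d) F
polyOn-sum {d} {f} {F} {K} pf F-step with antidifference pf
... | g , pg , Δg = (λ t → c + g t) , poly<-+ (poly<-≤ (s≤s z≤n) (poly<-const c)) pg , λ { (suc i) _ → agree i }
  where
  c = F 1 - g (fromℕ 1)
  agree : ∀ i → suc i ≤ K → F (suc i) ≡ c + g (fromℕ (suc i))
  agree zero    _    = split (F 1) (g (fromℕ 1))
    where
    split : ∀ x y → x ≡ (x - y) + y
    split = RingSolver.solve-∀ ℚ-ring
  agree (suc i) i<K = begin
    F (suc (suc i))                       ≡⟨ F-step (suc i) (s≤s z≤n) i<K ⟩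
    F (suc i) + f x                       ≡⟨ cong (_+ f x) (agree i (ℕP.<⇒≤ i<K)) ⟩
    (c + g x) + f x                       ≡⟨ ℚP.+-assoc c (g x) (f x) ⟩
    c + (g x + f x)                       ≡⟨ cong (λ y → c + y) (Δg x) ⟨
    c + g (x + 1ℚ)                        ≡⟨ cong (λ y → c + g y) (fromℕ-suc (suc i)) ⟨
    c + g (fromℕ (suc (suc i)))           ∎
    where
    open ≡-Reasoning
    x = fromℕ (suc i)

mulLin : ℤ → ℤ → (ℕ → ℤ) → ℕ → ℤ
mulLin a b φ zero    = b ℤ.* φ zero
mulLin a b φ (suc k) = b ℤ.* φ (suc k) ℤ.+ a ℤ.* φ k

mulPoch : ℤ → ℤ → ℕ → (ℕ → ℤ) → ℕ → ℤ
mulPoch a b zero    φ = φ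
mulPoch a b (suc k) φ = mulLin a (b ℤ.+ + k) (mulPoch a b k φ)

δ : ℕ → ℤ
δ = coeff oneP

module _ where
  open SetoidReasoning (ℕ →-setoid ℤ)

  private
    variable
      a b a′ b′ : ℤ
      k : ℕ
      φ ψ : ℕ → ℤ

  mulLin-cong : ∀ a b → φ ≗ ψ → mulLin a b φ ≗ mulLin a b ψ
  mulLin-cong a b φ≗ψ zero    = cong (b ℤ.*_) (φ≗ψ zero)
  mulLin-cong a b φ≗ψ (suc k) = cong₂ (λ x y → b ℤ.* x ℤ.+ a ℤ.* y) (φ≗ψ (suc k)) (φ≗ψ k)

  mulLin²-cong : ∀ a₁ b₁ a₂ b₂ → φ ≗ ψ → mulLin a₁ b₁ (mulLin a₂ b₂ φ) ≗ mulLin a₁ b₁ (mulLin a₂ b₂ ψ)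
  mulLin²-cong a₁ b₁ a₂ b₂ = mulLin-cong a₁ b₁ ∘ mulLin-cong a₂ b₂

  mulPoch-cong : ∀ a b k → φ ≗ ψ → mulPoch a b k φ ≗ mulPoch a b k ψ
  mulPoch-cong a b zero    φ≗ψ = φ≗ψ
  mulPoch-cong a b (suc k) φ≗ψ = mulLin-cong a (b ℤ.+ + k) (mulPoch-cong a b k φ≗ψ)

  mulLin-comm : ∀ a b a′ b′ φ → mulLin a b (mulLin a′ b′ φ) ≗ mulLin a′ b′ (mulLin a b φ)
  mulLin-comm a b a′ b′ φ zero          = comm₀ b b′ (φ 0)
    where
    comm₀ : ∀ b b′ x → b ℤ.* (b′ ℤ.* x) ≡ b′ ℤ.* (b ℤ.* x)
    comm₀ = solveℤ
  mulLin-comm a b a′ b′ φ (suc zero)    = comm₁ a b a′ b′ (φ 1) (φ 0)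
    where
    comm₁ : ∀ a b a′ b′ x₁ x₀ → b ℤ.* (b′ ℤ.* x₁ ℤ.+ a′ ℤ.* x₀) ℤ.+ a ℤ.* (b′ ℤ.* x₀)
                              ≡ b′ ℤ.* (b ℤ.* x₁ ℤ.+ a ℤ.* x₀) ℤ.+ a′ ℤ.* (b ℤ.* x₀)
    comm₁ = solveℤ
  mulLin-comm a b a′ b′ φ (suc (suc k)) = comm₂ a b a′ b′ (φ (suc (suc k))) (φ (suc k)) (φ k)
    where
    comm₂ : ∀ a b a′ b′ x₂ x₁ x₀ → b ℤ.* (b′ ℤ.* x₂ ℤ.+ a′ ℤ.* x₁) ℤ.+ a ℤ.* (b′ ℤ.* x₁ ℤ.+ a′ ℤ.* x₀)
                                 ≡ b′ ℤ.* (b ℤ.* x₂ ℤ.+ a ℤ.* x₁) ℤ.+ a′ ℤ.* (b ℤ.* x₁ ℤ.+ a ℤ.* x₀)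
    comm₂ = solveℤ

  mulLin-mulPoch-comm : ∀ a′ b′ a b k φ → mulLin a′ b′ (mulPoch a b k φ) ≗ mulPoch a b k (mulLin a′ b′ φ)
  mulLin-mulPoch-comm a′ b′ a b zero    φ = λ _ → refl
  mulLin-mulPoch-comm a′ b′ a b (suc k) φ = begin
    mulLin a′ b′ (mulLin a (b ℤ.+ + k) (mulPoch a b k φ))  ≈⟨ mulLin-comm a′ b′ a (b ℤ.+ + k) _ ⟩
    mulLin a (b ℤ.+ + k) (mulLin a′ b′ (mulPoch a b k φ))  ≈⟨ mulLin-cong a (b ℤ.+ + k) (mulLin-mulPoch-comm a′ b′ a b k φ) ⟩
    mulLin a (b ℤ.+ + k) (mulPoch a b k (mulLin a′ b′ φ))  ∎

  mulLin²-mulPoch-comm : ∀ a₁ b₁ a₂ b₂ a b k φ →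
    mulLin a₁ b₁ (mulLin a₂ b₂ (mulPoch a b k φ)) ≗ mulPoch a b k (mulLin a₁ b₁ (mulLin a₂ b₂ φ))
  mulLin²-mulPoch-comm a₁ b₁ a₂ b₂ a b k φ = begin
    mulLin a₁ b₁ (mulLin a₂ b₂ (mulPoch a b k φ))  ≈⟨ mulLin-cong a₁ b₁ (mulLin-mulPoch-comm a₂ b₂ a b k φ) ⟩
    mulLin a₁ b₁ (mulPoch a b k (mulLin a₂ b₂ φ))  ≈⟨ mulLin-mulPoch-comm a₁ b₁ a b k _ ⟩
    mulPoch a b k (mulLin a₁ b₁ (mulLin a₂ b₂ φ))  ∎

  mulLin²-mulLin²-comm : ∀ a₁ b₁ a₂ b₂ a₃ b₃ a₄ b₄ φ →
    mulLin a₁ b₁ (mulLin a₂ b₂ (mulLin a₃ b₃ (mulLin a₄ b₄ φ))) ≗ mulLin a₃ b₃ (mulLin a₄ b₄ (mulLin a₁ b₁ (mulLin a₂ b₂ φ)))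
  mulLin²-mulLin²-comm a₁ b₁ a₂ b₂ a₃ b₃ a₄ b₄ φ = begin
    mulLin a₁ b₁ (mulLin a₂ b₂ (mulLin a₃ b₃ (mulLin a₄ b₄ φ)))  ≈⟨ mulLin-cong a₁ b₁ (mulLin-comm a₂ b₂ a₃ b₃ _) ⟩
    mulLin a₁ b₁ (mulLin a₃ b₃ (mulLin a₂ b₂ (mulLin a₄ b₄ φ)))  ≈⟨ mulLin-comm a₁ b₁ a₃ b₃ _ ⟩
    mulLin a₃ b₃ (mulLin a₁ b₁ (mulLin a₂ b₂ (mulLin a₄ b₄ φ)))  ≈⟨ mulLin²-cong a₃ b₃ a₁ b₁ (mulLin-comm a₂ b₂ a₄ b₄ φ) ⟩
    mulLin a₃ b₃ (mulLin a₁ b₁ (mulLin a₄ b₄ (mulLin a₂ b₂ φ)))  ≈⟨ mulLin-cong a₃ b₃ (mulLin-comm a₁ b₁ a₄ b₄ _) ⟩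
    mulLin a₃ b₃ (mulLin a₄ b₄ (mulLin a₁ b₁ (mulLin a₂ b₂ φ)))  ∎

  mulPoch-suc : ∀ a b k φ → mulPoch a b (suc k) φ ≗ mulPoch a (b ℤ.+ + 1) k (mulLin a b φ)
  mulPoch-suc a b zero    φ i = cong (λ c → mulLin a c φ i) (ℤP.+-identityʳ b)
  mulPoch-suc a b (suc k) φ   = begin
    mulLin a (b ℤ.+ + suc k) (mulPoch a b (suc k) φ)                 ≈⟨ mulLin-cong a (b ℤ.+ + suc k) (mulPoch-suc a b k φ) ⟩
    mulLin a (b ℤ.+ + suc k) (mulPoch a (b ℤ.+ + 1) k (mulLin a b φ))  ≈⟨ (λ i → cong (λ c → mulLin a c (mulPoch a (b ℤ.+ + 1) k (mulLin a b φ)) i) (sym (ℤP.+-assoc b (+ 1) (+ k)))) ⟩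
    mulLin a ((b ℤ.+ + 1) ℤ.+ + k) (mulPoch a (b ℤ.+ + 1) k (mulLin a b φ))  ∎

  mulPoch-suc² : ∀ a c k φ → mulPoch a c (suc (suc k)) φ ≗ mulLin a (c ℤ.+ + 1) (mulLin a c (mulPoch a ((c ℤ.+ + 1) ℤ.+ + 1) k φ))
  mulPoch-suc² a c k φ = begin
    mulPoch a c (suc (suc k)) φ                                   ≈⟨ mulPoch-suc a c (suc k) φ ⟩
    mulPoch a (c ℤ.+ + 1) (suc k) (mulLin a c φ)                    ≈⟨ mulPoch-suc a (c ℤ.+ + 1) k _ ⟩
    mulPoch a c₂ k (mulLin a (c ℤ.+ + 1) (mulLin a c φ))            ≈⟨ mulLin²-mulPoch-comm a (c ℤ.+ + 1) a c a c₂ k φ ⟨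
    mulLin a (c ℤ.+ + 1) (mulLin a c (mulPoch a c₂ k φ))            ∎
    where c₂ = (c ℤ.+ + 1) ℤ.+ + 1

  mulPoch-ratio : ∀ s c L u β B t α φ →
    mulLin s (c ℤ.+ + 1) (mulLin s c (mulPoch s ((c ℤ.+ + 1) ℤ.+ + 1) L (mulPoch u β (suc B) (mulLin t α φ))))
    ≗ mulLin u β (mulLin t α (mulPoch s c (suc (suc L)) (mulPoch u (β ℤ.+ + 1) B φ)))
  mulPoch-ratio s c L u β B t α φ = begin
    S (mulPoch s c₂ L (mulPoch u β (suc B) (mulLin t α φ)))  ≈⟨ S-cong (mulPoch-cong s c₂ L (mulPoch-suc u β B _)) ⟩
    S (mulPoch s c₂ L (mulPoch u β₁ B (T φ)))                 ≈⟨ S-cong (mulPoch-cong s c₂ L (mulLin²-mulPoch-comm u β t α u β₁ B φ)) ⟨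
    S (mulPoch s c₂ L (T (mulPoch u β₁ B φ)))                 ≈⟨ S-cong (mulLin²-mulPoch-comm u β t α s c₂ L _) ⟨
    S (T (mulPoch s c₂ L (mulPoch u β₁ B φ)))                 ≈⟨ mulLin²-mulLin²-comm s (c ℤ.+ + 1) s c u β t α _ ⟩
    T (S (mulPoch s c₂ L (mulPoch u β₁ B φ)))                 ≈⟨ mulLin²-cong u β t α (mulPoch-suc² s c L _) ⟨
    T (mulPoch s c (suc (suc L)) (mulPoch u β₁ B φ))          ∎
    where
    c₂ = (c ℤ.+ + 1) ℤ.+ + 1
    β₁ = β ℤ.+ + 1
    S T : (ℕ → ℤ) → ℕ → ℤ
    S = mulLin s (c ℤ.+ + 1) ∘ mulLin s c
    T = mulLin u β ∘ mulLin t α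
    S-cong : ∀ {φ ψ} → φ ≗ ψ → S φ ≗ S ψ
    S-cong = mulLin²-cong s (c ℤ.+ + 1) s c

  VanishesFrom : ℕ → (ℕ → ℤ) → Set
  VanishesFrom d φ = ∀ k → d ≤ k → φ k ≡ + 0

  vanishesFrom-mulLin : VanishesFrom d φ → VanishesFrom (suc d) (mulLin a b φ)
  vanishesFrom-mulLin {a = a} {b} φ≈0 (suc k) (s≤s d≤k) =
    trans (cong₂ (λ x y → b ℤ.* x ℤ.+ a ℤ.* y) (φ≈0 (suc k) (ℕP.m≤n⇒m≤1+n d≤k)) (φ≈0 k d≤k)) (zeros b a)
    where
    zeros : ∀ b a → b ℤ.* + 0 ℤ.+ a ℤ.* + 0 ≡ + 0
    zeros = solveℤ

  vanishesFrom-mulPoch : ∀ k → VanishesFrom d φ → VanishesFrom (k ℕ.+ d) (mulPoch a b k φ)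
  vanishesFrom-mulPoch zero    φ≈0 = φ≈0
  vanishesFrom-mulPoch (suc k) φ≈0 = vanishesFrom-mulLin (vanishesFrom-mulPoch k φ≈0)

  δ-vanishesFrom : VanishesFrom 1 δ
  δ-vanishesFrom (suc k) _ = refl

  -- coefficients of X · Z in terms of those of Z
  convolve : List ℤ → (ℕ → ℤ) → ℕ → ℤ
  convolve []      φ k       = + 0
  convolve (c ∷ X) φ zero    = c ℤ.* φ zero
  convolve (c ∷ X) φ (suc k) = c ℤ.* φ (suc k) ℤ.+ convolve X φ k

  coeff-addP : ∀ P R k → coeff (addP P R) k ≡ coeff P k ℤ.+ coeff R k
  coeff-addP []      R       k       = sym (ℤP.+-identityˡ _)
  coeff-addP (a ∷ P) []      k       = sym (ℤP.+-identityʳ _)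
  coeff-addP (a ∷ P) (b ∷ R) zero    = refl
  coeff-addP (a ∷ P) (b ∷ R) (suc k) = coeff-addP P R k

  coeff-scaleP : ∀ c P k → coeff (scaleP c P) k ≡ c ℤ.* coeff P k
  coeff-scaleP c []      k       = sym (ℤP.*-zeroʳ c)
  coeff-scaleP c (a ∷ P) zero    = refl
  coeff-scaleP c (a ∷ P) (suc k) = coeff-scaleP c P k

  coeff-mulP : ∀ X Z → coeff (mulP X Z) ≗ convolve X (coeff Z)
  coeff-mulP []      Z k       = refl
  coeff-mulP (c ∷ X) Z zero    =
    trans (coeff-addP (scaleP c Z) _ 0) (trans (ℤP.+-identityʳ _) (coeff-scaleP c Z 0))
  coeff-mulP (c ∷ X) Z (suc k) =
    trans (coeff-addP (scaleP c Z) _ (suc k)) (cong₂ ℤ._+_ (coeff-scaleP c Z (suc k)) (coeff-mulP X Z k))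

  convolve-cong : ∀ X → φ ≗ ψ → convolve X φ ≗ convolve X ψ
  convolve-cong []      φ≗ψ k       = refl
  convolve-cong (c ∷ X) φ≗ψ zero    = cong (c ℤ.*_) (φ≗ψ zero)
  convolve-cong (c ∷ X) φ≗ψ (suc k) = cong₂ (λ x y → c ℤ.* x ℤ.+ y) (φ≗ψ (suc k)) (convolve-cong X φ≗ψ k)

  convolve-mulLin : ∀ X a b φ → convolve X (mulLin a b φ) ≗ mulLin a b (convolve X φ)
  convolve-mulLin []      a b φ zero          = sym (ℤP.*-zeroʳ b)
  convolve-mulLin []      a b φ (suc k)       = sym (zeros b a)
    where
    zeros : ∀ b a → b ℤ.* + 0 ℤ.+ a ℤ.* + 0 ≡ + 0
    zeros = solveℤ
  convolve-mulLin (c ∷ X) a b φ zero          = exchange c b (φ 0)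
    where
    exchange : ∀ c b x → c ℤ.* (b ℤ.* x) ≡ b ℤ.* (c ℤ.* x)
    exchange = solveℤ
  convolve-mulLin (c ∷ X) a b φ (suc zero)    =
    trans (cong (λ y → c ℤ.* mulLin a b φ 1 ℤ.+ y) (convolve-mulLin X a b φ 0)) (expand₁ a b c (φ 1) (φ 0) (convolve X φ 0))
    where
    expand₁ : ∀ a b c x₁ x₀ s₀ → c ℤ.* (b ℤ.* x₁ ℤ.+ a ℤ.* x₀) ℤ.+ b ℤ.* s₀
                                 ≡ b ℤ.* (c ℤ.* x₁ ℤ.+ s₀) ℤ.+ a ℤ.* (c ℤ.* x₀)
    expand₁ = solveℤ
  convolve-mulLin (c ∷ X) a b φ (suc (suc k)) =
    trans (cong (λ y → c ℤ.* mulLin a b φ (suc (suc k)) ℤ.+ y) (convolve-mulLin X a b φ (suc k)))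
          (expand₂ a b c (φ (suc (suc k))) (φ (suc k)) (convolve X φ (suc k)) (convolve X φ k))
    where
    expand₂ : ∀ a b c x₂ x₁ s₁ s₀ → c ℤ.* (b ℤ.* x₂ ℤ.+ a ℤ.* x₁) ℤ.+ (b ℤ.* s₁ ℤ.+ a ℤ.* s₀)
                                    ≡ b ℤ.* (c ℤ.* x₂ ℤ.+ s₁) ℤ.+ a ℤ.* (c ℤ.* x₁ ℤ.+ s₀)
    expand₂ = solveℤ

  convolve-mulPoch : ∀ X a b k φ → convolve X (mulPoch a b k φ) ≗ mulPoch a b k (convolve X φ)
  convolve-mulPoch X a b zero    φ = λ _ → refl
  convolve-mulPoch X a b (suc k) φ = begin
    convolve X (mulLin a (b ℤ.+ + k) (mulPoch a b k φ))  ≈⟨ convolve-mulLin X a (b ℤ.+ + k) _ ⟩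
    mulLin a (b ℤ.+ + k) (convolve X (mulPoch a b k φ))  ≈⟨ mulLin-cong a (b ℤ.+ + k) (convolve-mulPoch X a b k φ) ⟩
    mulLin a (b ℤ.+ + k) (mulPoch a b k (convolve X φ))  ∎

  convolve-δ : ∀ X → convolve X δ ≗ coeff X
  convolve-δ []      k       = refl
  convolve-δ (c ∷ X) zero    = ℤP.*-identityʳ c
  convolve-δ (c ∷ X) (suc k) =
    trans (cong₂ ℤ._+_ (ℤP.*-zeroʳ c) (convolve-δ X k)) (ℤP.+-identityˡ (coeff X k))

  coeff-linear : ∀ a b → coeff (b ∷ a ∷ []) ≗ mulLin a b δ
  coeff-linear a b zero          = sym (ℤP.*-identityʳ b)
  coeff-linear a b (suc zero)    = sym (linear₁ a b)
    where
    linear₁ : ∀ a b → b ℤ.* + 0 ℤ.+ a ℤ.* + 1 ≡ a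
    linear₁ = solveℤ
  coeff-linear a b (suc (suc k)) = sym (zeros b a)
    where
    zeros : ∀ b a → b ℤ.* + 0 ℤ.+ a ℤ.* + 0 ≡ + 0
    zeros = solveℤ

  coeff-pochLin : ∀ a b k → coeff (pochLin a b k) ≗ mulPoch a b k δ
  coeff-pochLin a b zero    = λ _ → refl
  coeff-pochLin a b (suc k) = begin
    coeff (mulP P (b ℤ.+ + k ∷ a ∷ []))         ≈⟨ coeff-mulP P _ ⟩
    convolve P (coeff (b ℤ.+ + k ∷ a ∷ []))     ≈⟨ convolve-cong P (coeff-linear a (b ℤ.+ + k)) ⟩
    convolve P (mulLin a (b ℤ.+ + k) δ)          ≈⟨ convolve-mulLin P a (b ℤ.+ + k) δ ⟩
    mulLin a (b ℤ.+ + k) (convolve P δ)          ≈⟨ mulLin-cong a (b ℤ.+ + k) (convolve-δ P) ⟩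
    mulLin a (b ℤ.+ + k) (coeff P)               ≈⟨ mulLin-cong a (b ℤ.+ + k) (coeff-pochLin a b k) ⟩
    mulLin a (b ℤ.+ + k) (mulPoch a b k δ)       ∎
    where P = pochLin a b k

  coeff-mulP-pochLin : ∀ X a b k → coeff (mulP X (pochLin a b k)) ≗ mulPoch a b k (coeff X)
  coeff-mulP-pochLin X a b k = begin
    coeff (mulP X (pochLin a b k))      ≈⟨ coeff-mulP X _ ⟩
    convolve X (coeff (pochLin a b k))  ≈⟨ convolve-cong X (coeff-pochLin a b k) ⟩
    convolve X (mulPoch a b k δ)        ≈⟨ convolve-mulPoch X a b k δ ⟩
    mulPoch a b k (convolve X δ)        ≈⟨ mulPoch-cong a b k (convolve-δ X) ⟩
    mulPoch a b k (coeff X)             ∎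

toℚ-mulLin-suc : ∀ a b φ k → toℚ (mulLin a b φ (suc k)) ≡ toℚ b * toℚ (φ (suc k)) + toℚ a * toℚ (φ k)
toℚ-mulLin-suc a b φ k = trans (toℚ-+ (b ℤ.* φ (suc k)) (a ℤ.* φ k)) (cong₂ _+_ (toℚ-* b (φ (suc k))) (toℚ-* a (φ k)))

toℚ-mulLin² : ∀ a b a′ b′ {A B A′ B′} φ r → toℚ a ≡ A → toℚ b ≡ B → toℚ a′ ≡ A′ → toℚ b′ ≡ B′ →
  toℚ (mulLin a′ b′ (mulLin a b φ) (suc (suc r)))
  ≡ B′ * (B * toℚ (φ (suc (suc r))) + A * toℚ (φ (suc r))) + A′ * (B * toℚ (φ (suc r)) + A * toℚ (φ r))
toℚ-mulLin² a b a′ b′ φ r refl refl refl refl =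
  trans (toℚ-mulLin-suc a′ b′ (mulLin a b φ) (suc r))
        (cong₂ (λ x y → toℚ b′ * x + toℚ a′ * y) (toℚ-mulLin-suc a b φ (suc r)) (toℚ-mulLin-suc a b φ r))

recurrenceTerm : (A B C X₁ X₂ Y₁ Y₂ : ℚ) → ℚ
recurrenceTerm A B C X₁ X₂ Y₁ Y₂ = ½ * B * A * X₂ + ½ * (B + B + A) * X₁ - (C + 1ℚ) * C * Y₂ - (C + C + 1ℚ) * Y₁

recurrenceTerm-cong : ∀ A B C {X₁ X₂ Y₁ Y₂ X₁′ X₂′ Y₁′ Y₂′} → X₁ ≡ X₁′ → X₂ ≡ X₂′ → Y₁ ≡ Y₁′ → Y₂ ≡ Y₂′ →
  recurrenceTerm A B C X₁ X₂ Y₁ Y₂ ≡ recurrenceTerm A B C X₁′ X₂′ Y₁′ Y₂′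
recurrenceTerm-cong A B C refl refl refl refl = refl

-- Solves (x + C)(x + C + 1) F = (x + B)(2x + A) G at the coefficient of x ^ (r + 2) for F's
-- coefficient of x ^ r, after scaling F by h P and G by P.
recurrence-solve : ∀ h P A B C F₀ F₁ F₂ G₀ G₁ G₂ → h + h ≡ 1ℚ →
  (C + 1ℚ) * (C * F₂ + 1ℚ * F₁) + 1ℚ * (C * F₁ + 1ℚ * F₀) ≡ B * (A * G₂ + (1ℚ + 1ℚ) * G₁) + 1ℚ * (A * G₁ + (1ℚ + 1ℚ) * G₀) →
  F₀ * (h * P) ≡ G₀ * P + (h * B * A * (G₂ * P) + h * (B + B + A) * (G₁ * P) - (C + 1ℚ) * C * (F₂ * (h * P)) - (C + C + 1ℚ) * (F₁ * (h * P)))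
recurrence-solve h P A B C F₀ F₁ F₂ G₀ G₁ G₂ h+h≡1 eq = begin
  F₀ * (h * P)                                      ≡⟨ expand h P A B C F₀ F₁ F₂ G₀ G₁ G₂ ⟩
  D + h * P * (lhs - rhs) + (h + h - 1ℚ) * (G₀ * P)  ≡⟨ cong₂ (λ x y → D + h * P * (x - rhs) + (y - 1ℚ) * (G₀ * P)) eq h+h≡1 ⟩
  D + h * P * (rhs - rhs) + (1ℚ - 1ℚ) * (G₀ * P)    ≡⟨ cancel D (h * P) rhs (G₀ * P) ⟩
  D                                                 ∎
  where
  open ≡-Reasoning
  lhs = (C + 1ℚ) * (C * F₂ + 1ℚ * F₁) + 1ℚ * (C * F₁ + 1ℚ * F₀)
  rhs = B * (A * G₂ + (1ℚ + 1ℚ) * G₁) + 1ℚ * (A * G₁ + (1ℚ + 1ℚ) * G₀)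
  D = G₀ * P + (h * B * A * (G₂ * P) + h * (B + B + A) * (G₁ * P) - (C + 1ℚ) * C * (F₂ * (h * P)) - (C + C + 1ℚ) * (F₁ * (h * P)))
  expand : ∀ h P A B C F₀ F₁ F₂ G₀ G₁ G₂ →
    F₀ * (h * P)
    ≡ (G₀ * P + (h * B * A * (G₂ * P) + h * (B + B + A) * (G₁ * P) - (C + 1ℚ) * C * (F₂ * (h * P)) - (C + C + 1ℚ) * (F₁ * (h * P))))
      + h * P * (((C + 1ℚ) * (C * F₂ + 1ℚ * F₁) + 1ℚ * (C * F₁ + 1ℚ * F₀)) - (B * (A * G₂ + (1ℚ + 1ℚ) * G₁) + 1ℚ * (A * G₁ + (1ℚ + 1ℚ) * G₀)))
      + (h + h - 1ℚ) * (G₀ * P)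
  expand = RingSolver.solve-∀ ℚ-ring
  cancel : ∀ D Q R Z → D + Q * (R - R) + (1ℚ - 1ℚ) * Z ≡ D
  cancel = RingSolver.solve-∀ ℚ-ring

module Coefficients (m n₀ : ℕ) where

  h K N : ℕ
  h = ⌊ m /2⌋
  K = suc n₀
  N = suc (n₀ ℕ.+ n₀ ℕ.+ h)

  n α₀ : ℤ
  n  = + suc K
  α₀ = + m ℤ.+ ℤ.+ 1

  β c : ℕ → ℤ
  β j = ℤ.+ 2 ℤ.- + j
  c j = + m ℤ.+ ℤ.+ 2 ℤ.* + j ℤ.+ ℤ.+ 1

  lenB lenC : ℕ → ℕ
  lenB j = ⌊ m /2⌋ ℕ.+ j ∸ 1
  lenC j = ∣ ℤ.+ 2 ℤ.* n ℤ.- ℤ.+ 2 ℤ.* + j ℤ.- ℤ.+ 2 ∣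

  Q : ℕ → Poly
  Q j = mulP (mulP (pochLin (ℤ.+ 2) α₀ j) (pochLin (ℤ.+ 1) (β j) (lenB j))) (pochLin (ℤ.+ 1) (c j) (lenC j))

  q : ℕ → ℕ → ℤ
  q j = coeff (Q j)

  A : ℕ → ℕ → ℤ
  A j = mulPoch (+ 2) α₀ j δ

  q-mulPoch : ∀ j → q j ≗ mulPoch (+ 1) (c j) (lenC j) (mulPoch (+ 1) (β j) (lenB j) (A j))
  q-mulPoch j = begin
    coeff (mulP (mulP PA PB) (pochLin (+ 1) (c j) (lenC j)))  ≈⟨ coeff-mulP-pochLin (mulP PA PB) (+ 1) (c j) (lenC j) ⟩
    mulPoch (+ 1) (c j) (lenC j) (coeff (mulP PA PB))         ≈⟨ mulPoch-cong (+ 1) (c j) (lenC j) (coeff-mulP-pochLin PA (+ 1) (β j) (lenB j)) ⟩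
    mulPoch (+ 1) (c j) (lenC j) (mulPoch (+ 1) (β j) (lenB j) (coeff PA))
                                                              ≈⟨ mulPoch-cong (+ 1) (c j) (lenC j) (mulPoch-cong (+ 1) (β j) (lenB j) (coeff-pochLin (+ 2) α₀ j)) ⟩
    mulPoch (+ 1) (c j) (lenC j) (mulPoch (+ 1) (β j) (lenB j) (A j)) ∎
    where
    open SetoidReasoning (ℕ →-setoid ℤ)
    PA = pochLin (+ 2) α₀ j
    PB = pochLin (+ 1) (β j) (lenB j)

  c-suc : ∀ j → c (suc j) ≡ (c j ℤ.+ + 1) ℤ.+ + 1
  c-suc j = shift (+ m) (+ j)
    where
    shift : ∀ m j → m ℤ.+ + 2 ℤ.* (+ 1 ℤ.+ j) ℤ.+ + 1 ≡ ((m ℤ.+ + 2 ℤ.* j ℤ.+ + 1) ℤ.+ + 1) ℤ.+ + 1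
    shift = solveℤ

  β-suc : ∀ j → β (suc j) ℤ.+ + 1 ≡ β j
  β-suc j = shift (+ j)
    where
    shift : ∀ j → (+ 2 ℤ.- (+ 1 ℤ.+ j)) ℤ.+ + 1 ≡ + 2 ℤ.- j
    shift = solveℤ

  lenB-suc : ∀ j → lenB (suc j) ≡ h ℕ.+ j
  lenB-suc j = cong (_∸ 1) (ℕP.+-suc h j)

  lenB-suc-suc : ∀ j → 1 ≤ j → lenB (suc j) ≡ suc (lenB j)
  lenB-suc-suc (suc j) _ = trans (lenB-suc (suc j)) (trans (ℕP.+-suc h j) (cong suc (sym (lenB-suc j))))

  lenC-≡ : ∀ j d → j ℕ.+ d ≡ K → lenC j ≡ d ℕ.+ d
  lenC-≡ j d j+d≡K = begin
    lenC j                                                             ≡⟨ cong (λ x → ∣ + 2 ℤ.* + suc x ℤ.- + 2 ℤ.* + j ℤ.- + 2 ∣) (sym j+d≡K) ⟩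
    ∣ + 2 ℤ.* (+ 1 ℤ.+ + (j ℕ.+ d)) ℤ.- + 2 ℤ.* + j ℤ.- + 2 ∣          ≡⟨ cong (λ x → ∣ + 2 ℤ.* (+ 1 ℤ.+ x) ℤ.- + 2 ℤ.* + j ℤ.- + 2 ∣) (ℤP.pos-+ j d) ⟩
    ∣ + 2 ℤ.* (+ 1 ℤ.+ (+ j ℤ.+ + d)) ℤ.- + 2 ℤ.* + j ℤ.- + 2 ∣        ≡⟨ cong ∣_∣ (double (+ j) (+ d)) ⟩
    ∣ + d ℤ.+ + d ∣                                                    ≡⟨ cong ∣_∣ (ℤP.pos-+ d d) ⟨
    d ℕ.+ d                                                            ∎
    where
    open ≡-Reasoning
    double : ∀ j d → + 2 ℤ.* (+ 1 ℤ.+ (j ℤ.+ d)) ℤ.- + 2 ℤ.* j ℤ.- + 2 ≡ d ℤ.+ d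
    double = solveℤ

  lenC-suc : ∀ j → suc j ≤ K → lenC j ≡ suc (suc (lenC (suc j)))
  lenC-suc j j<K = begin
    lenC j                       ≡⟨ lenC-≡ j (suc k) (trans (ℕP.+-suc j k) j+k≡K) ⟩
    suc k ℕ.+ suc k              ≡⟨ cong suc (ℕP.+-suc k k) ⟩
    suc (suc (k ℕ.+ k))          ≡⟨ cong (suc ∘ suc) (lenC-≡ (suc j) k j+k≡K) ⟨
    suc (suc (lenC (suc j)))     ∎
    where
    open ≡-Reasoning
    k = K ∸ suc j
    j+k≡K = ℕP.m+[n∸m]≡n j<K

  degree-≡ : ∀ j → 1 ≤ j → j ≤ K → lenC j ℕ.+ (lenB j ℕ.+ (j ℕ.+ 1)) ≡ suc N
  degree-≡ (suc i) _ j≤K = begin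
    lenC (suc i) ℕ.+ (lenB (suc i) ℕ.+ (suc i ℕ.+ 1))
      ≡⟨ cong₂ (λ x y → x ℕ.+ (y ℕ.+ (suc i ℕ.+ 1))) (lenC-≡ (suc i) k j+k≡K) (lenB-suc i) ⟩
    k ℕ.+ k ℕ.+ (h ℕ.+ i ℕ.+ (suc i ℕ.+ 1))        ≡⟨ count k h i ⟩
    suc (suc ((i ℕ.+ k) ℕ.+ (i ℕ.+ k) ℕ.+ h))      ≡⟨ cong (λ n → suc (suc (n ℕ.+ n ℕ.+ h))) (ℕP.suc-injective j+k≡K) ⟩
    suc N                                          ∎
    where
    open ≡-Reasoning
    k = K ∸ suc i
    j+k≡K = ℕP.m+[n∸m]≡n j≤K
    count : ∀ d h i → d ℕ.+ d ℕ.+ (h ℕ.+ i ℕ.+ (suc i ℕ.+ 1)) ≡ suc (suc ((i ℕ.+ d) ℕ.+ (i ℕ.+ d) ℕ.+ h))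
    count = solveℕ

  q-vanishesFrom : ∀ j → 1 ≤ j → j ≤ K → VanishesFrom (suc N) (q j)
  q-vanishesFrom j 1≤j j≤K k N<k = trans (q-mulPoch j k) (vanishes k (ℕP.≤-trans (ℕP.≤-reflexive (degree-≡ j 1≤j j≤K)) N<k))
    where
    vanishes = vanishesFrom-mulPoch (lenC j) (vanishesFrom-mulPoch (lenB j) (vanishesFrom-mulPoch j δ-vanishesFrom))

  q-recurrence : ∀ j → 1 ≤ j → suc j ≤ K →
    mulLin (+ 1) (c j ℤ.+ + 1) (mulLin (+ 1) (c j) (q (suc j))) ≗ mulLin (+ 1) (β (suc j)) (mulLin (+ 2) (α₀ ℤ.+ + j) (q j))
  q-recurrence j 1≤j j<K = begin
    mulLin (+ 1) (c j ℤ.+ + 1) (mulLin (+ 1) (c j) (q (suc j)))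
      ≈⟨ mulLin²-cong (+ 1) (c j ℤ.+ + 1) (+ 1) (c j) q-suc ⟩
    mulLin (+ 1) (c j ℤ.+ + 1) (mulLin (+ 1) (c j) (mulPoch (+ 1) ((c j ℤ.+ + 1) ℤ.+ + 1) (lenC (suc j))
      (mulPoch (+ 1) (β (suc j)) (suc (lenB j)) (mulLin (+ 2) (α₀ ℤ.+ + j) (A j)))))
      ≈⟨ mulPoch-ratio (+ 1) (c j) (lenC (suc j)) (+ 1) (β (suc j)) (lenB j) (+ 2) (α₀ ℤ.+ + j) (A j) ⟩
    mulLin (+ 1) (β (suc j)) (mulLin (+ 2) (α₀ ℤ.+ + j) (mulPoch (+ 1) (c j) (suc (suc (lenC (suc j))))
      (mulPoch (+ 1) (β (suc j) ℤ.+ + 1) (lenB j) (A j))))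
      ≈⟨ mulLin²-cong (+ 1) (β (suc j)) (+ 2) (α₀ ℤ.+ + j) q-now ⟨
    mulLin (+ 1) (β (suc j)) (mulLin (+ 2) (α₀ ℤ.+ + j) (q j)) ∎
    where
    open SetoidReasoning (ℕ →-setoid ℤ)
    q-suc : q (suc j) ≗ mulPoch (+ 1) ((c j ℤ.+ + 1) ℤ.+ + 1) (lenC (suc j)) (mulPoch (+ 1) (β (suc j)) (suc (lenB j)) (A (suc j)))
    q-suc i = trans (q-mulPoch (suc j) i)
      (cong₂ (λ c′ l → mulPoch (+ 1) c′ (lenC (suc j)) (mulPoch (+ 1) (β (suc j)) l (A (suc j))) i) (c-suc j) (lenB-suc-suc j 1≤j))
    q-now : q j ≗ mulPoch (+ 1) (c j) (suc (suc (lenC (suc j)))) (mulPoch (+ 1) (β (suc j) ℤ.+ + 1) (lenB j) (A j))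
    q-now i = trans (q-mulPoch j i)
      (cong₂ (λ l b → mulPoch (+ 1) (c j) l (mulPoch (+ 1) b (lenB j) (A j)) i) (lenC-suc j j<K) (sym (β-suc j)))

  M : ℚ
  M = fromℕ m

  b : ℕ → ℕ → ℚ
  b r j = toℚ (q j r) * ½ ^ j

  toℚ-α₀+ : ∀ j → toℚ (α₀ ℤ.+ + j) ≡ M + 1ℚ + fromℕ j
  toℚ-α₀+ j = trans (toℚ-+ α₀ (+ j)) (cong (_+ fromℕ j) (toℚ-+ (+ m) (+ 1)))

  toℚ-β-suc : ∀ j → toℚ (β (suc j)) ≡ 1ℚ - fromℕ j
  toℚ-β-suc j = trans (toℚ-+ (+ 2) (ℤ.- + suc j)) (trans (cong (λ x → (1ℚ + 1ℚ) - x) (fromℕ-suc j)) (simplify (fromℕ j)))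
    where
    simplify : ∀ t → (1ℚ + 1ℚ) - (t + 1ℚ) ≡ 1ℚ - t
    simplify = RingSolver.solve-∀ ℚ-ring

  toℚ-c : ∀ j → toℚ (c j) ≡ M + fromℕ j + fromℕ j + 1ℚ
  toℚ-c j = begin
    toℚ (+ m ℤ.+ + 2 ℤ.* + j ℤ.+ + 1)  ≡⟨ toℚ-+ (+ m ℤ.+ + 2 ℤ.* + j) (+ 1) ⟩
    toℚ (+ m ℤ.+ + 2 ℤ.* + j) + 1ℚ     ≡⟨ cong (_+ 1ℚ) (trans (toℚ-+ (+ m) (+ 2 ℤ.* + j)) (cong (λ y → M + y) (toℚ-* (+ 2) (+ j)))) ⟩
    M + (1ℚ + 1ℚ) * fromℕ j + 1ℚ       ≡⟨ double M (fromℕ j) ⟩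
    M + fromℕ j + fromℕ j + 1ℚ         ∎
    where
    open ≡-Reasoning
    double : ∀ M t → M + (1ℚ + 1ℚ) * t + 1ℚ ≡ M + t + t + 1ℚ
    double = RingSolver.solve-∀ ℚ-ring

  b-recurrence : ∀ r j → 1 ≤ j → suc j ≤ K →
    b r (suc j) ≡ b r j + recurrenceTerm (M + 1ℚ + fromℕ j) (1ℚ - fromℕ j) (M + fromℕ j + fromℕ j + 1ℚ)
                            (b (suc r) j) (b (suc (suc r)) j) (b (suc r) (suc j)) (b (suc (suc r)) (suc j))
  b-recurrence r j 1≤j j<K =
    recurrence-solve ½ (½ ^ j) (M + 1ℚ + t) (1ℚ - t) C
      (next 0) (next 1) (next 2) (this 0) (this 1) (this 2) refl
      (begin
        (C + 1ℚ) * (C * next 2 + 1ℚ * next 1) + 1ℚ * (C * next 1 + 1ℚ * next 0)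
          ≡⟨ toℚ-mulLin² (+ 1) (c j) (+ 1) (c j ℤ.+ + 1) (q (suc j)) r refl (toℚ-c j) refl (trans (toℚ-+ (c j) (+ 1)) (cong (_+ 1ℚ) (toℚ-c j))) ⟨
        toℚ (mulLin (+ 1) (c j ℤ.+ + 1) (mulLin (+ 1) (c j) (q (suc j))) (suc (suc r)))
          ≡⟨ cong toℚ (q-recurrence j 1≤j j<K (suc (suc r))) ⟩
        toℚ (mulLin (+ 1) (β (suc j)) (mulLin (+ 2) (α₀ ℤ.+ + j) (q j)) (suc (suc r)))
          ≡⟨ toℚ-mulLin² (+ 2) (α₀ ℤ.+ + j) (+ 1) (β (suc j)) (q j) r refl (toℚ-α₀+ j) refl (toℚ-β-suc j) ⟩
        (1ℚ - t) * ((M + 1ℚ + t) * this 2 + (1ℚ + 1ℚ) * this 1) + 1ℚ * ((M + 1ℚ + t) * this 1 + (1ℚ + 1ℚ) * this 0) ∎)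
    where
    open ≡-Reasoning
    t = fromℕ j
    C = M + t + t + 1ℚ
    next this : ℕ → ℚ
    next i = toℚ (q (suc j) (i ℕ.+ r))
    this i = toℚ (q j (i ℕ.+ r))

  Δ : (ℚ → ℚ) → (ℚ → ℚ) → ℚ → ℚ
  Δ P₁ P₂ t = recurrenceTerm (M + 1ℚ + t) (1ℚ - t) (M + t + t + 1ℚ) (P₁ t) (P₂ t) (P₁ (t + 1ℚ)) (P₂ (t + 1ℚ))

  poly<-Δ : ∀ {P₁ P₂} → Poly< (suc d) P₁ → Poly< d P₂ → Poly< (suc (suc d)) (Δ P₁ P₂)
  poly<-Δ {P₁ = P₁} {P₂} p₁ p₂ =
    poly<-cong (λ t → regroup ½ M t (P₁ t) (P₂ t) (P₁ (t + 1ℚ)) (P₂ (t + 1ℚ)))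
      (poly<-+ (poly<-+ (poly<-linear* ½ (- ½) (poly<-linear* (M + 1ℚ) 1ℚ p₂))
                        (poly<-linear* (½ * (M + 1ℚ + 1ℚ + 1ℚ)) (- ½) p₁))
               (poly<-+ (poly<-linear* (- (M + 1ℚ + 1ℚ)) (- (1ℚ + 1ℚ)) (poly<-linear* (M + 1ℚ) (1ℚ + 1ℚ) (poly<-shift p₂)))
                        (poly<-linear* (- (M + M + 1ℚ + 1ℚ + 1ℚ)) (- (1ℚ + 1ℚ + 1ℚ + 1ℚ)) (poly<-shift p₁))))
    where
    regroup : ∀ h M t X₁ X₂ Y₁ Y₂ →
      (h + (- h) * t) * ((M + 1ℚ + 1ℚ * t) * X₂) + (h * (M + 1ℚ + 1ℚ + 1ℚ) + (- h) * t) * X₁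
      + ((- (M + 1ℚ + 1ℚ) + (- (1ℚ + 1ℚ)) * t) * ((M + 1ℚ + (1ℚ + 1ℚ) * t) * Y₂)
         + (- (M + M + 1ℚ + 1ℚ + 1ℚ) + (- (1ℚ + 1ℚ + 1ℚ + 1ℚ)) * t) * Y₁)
      ≡ h * (1ℚ - t) * (M + 1ℚ + t) * X₂ + h * ((1ℚ - t) + (1ℚ - t) + (M + 1ℚ + t)) * X₁
        - ((M + t + t + 1ℚ) + 1ℚ) * (M + t + t + 1ℚ) * Y₂ - ((M + t + t + 1ℚ) + (M + t + t + 1ℚ) + 1ℚ) * Y₁
    regroup = RingSolver.solve-∀ ℚ-ring

  Δ-zero : Poly< 0 (Δ (λ _ → 0ℚ) (λ _ → 0ℚ))
  Δ-zero = poly<-cong (λ t → sym (vanish ½ (M + 1ℚ + t) (1ℚ - t) (M + t + t + 1ℚ))) (poly<-zero 0)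
    where
    vanish : ∀ h A B C → h * B * A * 0ℚ + h * (B + B + A) * 0ℚ - (C + 1ℚ) * C * 0ℚ - (C + C + 1ℚ) * 0ℚ ≡ 0ℚ
    vanish = RingSolver.solve-∀ ℚ-ring

  b-polyOn-step : ∀ r {P₁ P₂} → AgreesOn K (b (suc r)) P₁ → AgreesOn K (b (suc (suc r))) P₂ →
                  Poly< d (Δ P₁ P₂) → PolyOn K (suc d) (b r)
  b-polyOn-step r {P₁} {P₂} b≈P₁ b≈P₂ pΔ = polyOn-sum pΔ λ j 1≤j j<K →
    let t = fromℕ j
        at : ∀ {F} P → AgreesOn K F P → F j ≡ P t
        at P F≈P = F≈P j 1≤j (ℕP.<⇒≤ j<K)
        at-suc : ∀ {F} P → AgreesOn K F P → F (suc j) ≡ P (t + 1ℚ)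
        at-suc P F≈P = trans (F≈P (suc j) (s≤s z≤n) j<K) (cong P (fromℕ-suc j))
    in trans (b-recurrence r j 1≤j j<K)
             (cong (λ y → b r j + y) (recurrenceTerm-cong (M + 1ℚ + t) (1ℚ - t) (M + t + t + 1ℚ)
               (at P₁ b≈P₁) (at P₂ b≈P₂) (at-suc P₁ b≈P₁) (at-suc P₂ b≈P₂)))

  b-vanishes : ∀ r → N < r → AgreesOn K (b r) (λ _ → 0ℚ)
  b-vanishes r N<r j 1≤j j≤K = trans (cong (λ z → toℚ z * ½ ^ j) (q-vanishesFrom j 1≤j j≤K r N<r)) (ℚP.*-zeroˡ (½ ^ j))

  b-polyOn : ∀ k r → r ℕ.+ k ≡ N → PolyOn K (suc (k ℕ.+ k)) (b r) × PolyOn K (k ℕ.+ k) (b (suc r))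
  b-polyOn zero r r+0≡N = b-polyOn-step r b₁≈0 b₂≈0 Δ-zero , (λ _ → 0ℚ) , poly<-zero 0 , b₁≈0
    where
    N<suc-r : N < suc r
    N<suc-r = s≤s (ℕP.≤-reflexive (trans (sym r+0≡N) (ℕP.+-identityʳ r)))
    b₁≈0 = b-vanishes (suc r) N<suc-r
    b₂≈0 = b-vanishes (suc (suc r)) (ℕP.m≤n⇒m≤1+n N<suc-r)
  b-polyOn (suc k) r r+k+1≡N with b-polyOn k (suc r) (trans (sym (ℕP.+-suc r k)) r+k+1≡N)
  ... | (P₁ , p₁ , b≈P₁) , (P₂ , p₂ , b≈P₂) =
    polyOn-≤ (ℕP.≤-reflexive (cong (suc ∘ suc) (sym (ℕP.+-suc k k)))) (b-polyOn-step r b≈P₁ b≈P₂ (poly<-Δ p₁ p₂)) ,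
    polyOn-≤ (ℕP.≤-trans (ℕP.n≤1+n _) (ℕP.≤-reflexive (cong suc (sym (ℕP.+-suc k k))))) (P₁ , p₁ , b≈P₁)

  q-polynomial : ∀ p D k → p ℕ.+ k ≡ N → k ℕ.+ k ≡ D →
    Σ (Vec ℚ (suc D)) λ cs → ∀ j → 1 ≤ j → j ≤ K → toℚ (q j p) ≡ toℚ (+ (2 ℕ.^ j)) * evalℚ cs (fromℕ j)
  q-polynomial p _ k p+k≡N refl with proj₁ (b-polyOn k p p+k≡N)
  ... | P , (cs , P≗cs) , b≈P = cs , λ j 1≤j j≤K →
    trans (*½^-unscale j (toℚ (q j p))) (cong (toℚ (+ (2 ℕ.^ j)) *_) (trans (b≈P j 1≤j j≤K) (P≗cs (fromℕ j))))

  bound-≡ : ℤ.+ 2 ℤ.* n ℤ.+ + h ℤ.- ℤ.+ 3 ≡ + N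
  bound-≡ = begin
    + 2 ℤ.* (+ 1 ℤ.+ (+ 1 ℤ.+ + n₀)) ℤ.+ + h ℤ.- + 3  ≡⟨ arith (+ n₀) (+ h) ⟩
    + 1 ℤ.+ ((+ n₀ ℤ.+ + n₀) ℤ.+ + h)                 ≡⟨ cong (λ x → + 1 ℤ.+ (x ℤ.+ + h)) (ℤP.pos-+ n₀ n₀) ⟨
    + 1 ℤ.+ (+ (n₀ ℕ.+ n₀) ℤ.+ + h)                   ≡⟨ cong (λ x → + 1 ℤ.+ x) (ℤP.pos-+ (n₀ ℕ.+ n₀) h) ⟨
    + N                                               ∎
    where
    open ≡-Reasoning
    arith : ∀ a b → + 2 ℤ.* (+ 1 ℤ.+ (+ 1 ℤ.+ a)) ℤ.+ b ℤ.- + 3 ≡ + 1 ℤ.+ ((a ℤ.+ a) ℤ.+ b)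
    arith = solveℤ

  twice-gap : ∀ p → p ≤ N → ∣ ℤ.+ 2 ℤ.* (ℤ.+ 2 ℤ.* n ℤ.+ + h ℤ.- ℤ.+ 3 ℤ.- + p) ∣ ≡ (N ∸ p) ℕ.+ (N ∸ p)
  twice-gap p p≤N = cong ∣_∣ (begin
    + 2 ℤ.* (ℤ.+ 2 ℤ.* n ℤ.+ + h ℤ.- ℤ.+ 3 ℤ.- + p)  ≡⟨ cong (λ x → + 2 ℤ.* (x ℤ.- + p)) (trans bound-≡ (cong +_ (sym (ℕP.m+[n∸m]≡n p≤N)))) ⟩
    + 2 ℤ.* (+ (p ℕ.+ k) ℤ.- + p)                    ≡⟨ cong (λ x → + 2 ℤ.* (x ℤ.- + p)) (ℤP.pos-+ p k) ⟩
    + 2 ℤ.* ((+ p ℤ.+ + k) ℤ.- + p)                  ≡⟨ arith (+ p) (+ k) ⟩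
    + k ℤ.+ + k                                      ≡⟨ ℤP.pos-+ k k ⟨
    + (k ℕ.+ k)                                      ∎)
    where
    open ≡-Reasoning
    k = N ∸ p
    arith : ∀ p k → + 2 ℤ.* ((p ℤ.+ k) ℤ.- p) ≡ k ℤ.+ k
    arith = solveℤ

lemmaA9 : (n : ℤ) (m p : ℕ) →
    + p ℤ.≤ ℤ.+ 2 ℤ.* n ℤ.+ + ⌊ m /2⌋ ℤ.- ℤ.+ 3 →
    Σ (Vec ℚ (ℕ.suc ∣ ℤ.+ 2 ℤ.* (ℤ.+ 2 ℤ.* n ℤ.+ + ⌊ m /2⌋ ℤ.- ℤ.+ 3 ℤ.- + p) ∣)) λ β →
      (j : ℕ) → 1 ℕ.≤ j → + j ℤ.≤ n ℤ.- ℤ.+ 1 →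
        toℚ (coeff
          (mulP (mulP (pochLin (ℤ.+ 2) (+ m ℤ.+ ℤ.+ 1) j)
                      (pochLin (ℤ.+ 1) (ℤ.+ 2 ℤ.- + j) (⌊ m /2⌋ ℕ.+ j ∸ 1)))
                (pochLin (ℤ.+ 1) (+ m ℤ.+ ℤ.+ 2 ℤ.* + j ℤ.+ ℤ.+ 1)
                         ∣ ℤ.+ 2 ℤ.* n ℤ.- ℤ.+ 2 ℤ.* + j ℤ.- ℤ.+ 2 ∣))
          p)
        ≡ toℚ (ℤ.+ (2 ℕ.^ j)) ℚ.* evalℚ β (toℚ (+ j))
lemmaA9 ℤ.-[1+ _ ]        m p _ = Vec.replicate _ 0ℚ , λ _ _ ()
lemmaA9 (+ 0)             m p _ = Vec.replicate _ 0ℚ , λ _ _ ()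
lemmaA9 (+ 1)             m p _ = Vec.replicate _ 0ℚ , λ { (suc _) _ (ℤ.+≤+ ()) }
lemmaA9 (+ suc (suc n₀))  m p p≤bound =
  Product.map₂ (λ eq j 1≤j j≤K → eq j 1≤j (ℤP.drop‿+≤+ j≤K))
               (q-polynomial p _ (N ∸ p) (ℕP.m+[n∸m]≡n p≤N) (sym (twice-gap p p≤N)))
  where
  open Coefficients m n₀
  p≤N : p ≤ N
  p≤N = ℤP.drop‿+≤+ (subst (+ p ℤ.≤_) bound-≡ p≤bound)
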